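{- (i) Let $p$ be a prime and let $M\subset\mathbb{Z}^2$ be a set of points such that the distance between any two points of $M$ is an integer divisible by $p$. Then there is a Euclidean motion $T$ of $\mathbb{R}^2$ such that $TM\subset(p\mathbb{Z})^2$. (ii) Consequently, if $M\subset\mathbb{Q}^2$ is a set of points such that the distance between any two points of $M$ is an integer, then there is a Euclidean motion $T$ of $\mathbb{R}^2$ with $TM\subset\mathbb{Z}^2$.
   Context: A Euclidean motion of $\mathbb{R}^n$ is a distance-preserving map $\mathbb{R}^n\to\mathbb{R}^n$ (composition of an orthogonal map and a translation). -}

module Defs where

open import Data.Nat as ℕ using (ℕ)
open import Data.Nat.Divisibility using (_∣_)
open import Data.Nat.Primality using (Prime)
open import Data.Integer as ℤ using (ℤ; +_)
open import Data.Rational as ℚ using (ℚ)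
open import Data.Product using (Σ; _×_; _,_)
open import Relation.Binary.PropositionalEquality using (_≡_)
open import Relation.Nullary using (¬_)

ιℤ : ℤ → ℚ
ιℤ z = z ℚ./ 1

ℚ² : Set
ℚ² = ℚ × ℚ

ℤ² : Set
ℤ² = ℤ × ℤ

ι² : ℤ² → ℚ²
ι² (a , b) = (ιℤ a , ιℤ b)

dist²ℚ : ℚ² → ℚ² → ℚ
dist²ℚ (x₁ , y₁) (x₂ , y₂) =
  ((x₁ ℚ.- x₂) ℚ.* (x₁ ℚ.- x₂)) ℚ.+ ((y₁ ℚ.- y₂) ℚ.* (y₁ ℚ.- y₂))

DistIs : ℚ² → ℚ² → ℕ → Set
DistIs x y k = ιℤ (+ (k ℕ.* k)) ≡ dist²ℚ x y

IsMotion : (ℚ² → ℚ²) → Set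
IsMotion T = ∀ x y → dist²ℚ (T x) (T y) ≡ dist²ℚ x y

In-pℤ² : ℕ → ℚ² → Set
In-pℤ² p x = Σ ℤ λ a → Σ ℤ λ b → x ≡ (ιℤ (+ p ℤ.* a) , ιℤ (+ p ℤ.* b))

Inℤ² : ℚ² → Set
Inℤ² x = Σ ℤ λ a → Σ ℤ λ b → x ≡ (ιℤ a , ιℤ b)

Part-i : Set₁
Part-i =
  (p : ℕ) → Prime p → (M : ℤ² → Set) →
  (∀ x y → M x → M y → Σ ℕ λ k → (p ∣ k) × DistIs (ι² x) (ι² y) k) →
  ¬ ¬ (Σ (ℚ² → ℚ²) λ T → IsMotion T × (∀ x → M x → In-pℤ² p (T (ι² x))))

Part-ii : Set₁
Part-ii =
  (M : ℚ² → Set) →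
  (∀ x y → M x → M y → Σ ℕ λ k → DistIs x y k) →
  ¬ ¬ (Σ (ℚ² → ℚ²) λ T → IsMotion T × (∀ x → M x → Inℤ² (T x)))

{-# OPTIONS --safe #-}
-- Read ℤ² and ℚ² as the Gaussian integers and rationals, so that |z|² = norm z and z ↦ ω z / |ω| is a rotation.
--
-- (i) Let p be prime and m₀ ∈ M. If x ≡ m₀ mod p for all x ∈ M, a translation works. Otherwise some z₀ = w − m₀
-- has p ∤ Im z₀ although p² ∣ |z₀|². Thue's lemma (pigeonhole on a ⌊√p⌋-box) gives π with |π|² = p and π ∣ z₀;
-- in fact π² ∣ z₀, so ω = π̄² has |ω| = p and ω z₀ ∈ p²ℤ[i]. For any other z = x − m₀ the norms |z|², |z₀|² and
-- |z − z₀|² are divisible by p², hence so is 2 Re(z̄₀ z) by polarization, hence Re(z̄₀ z) (here p is odd), hence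
-- Im(z̄₀ z) because |z̄₀ z|² = |z₀|² |z|². So z is parallel to z₀ modulo p², ω z ∈ p²ℤ[i] too, and z ↦ ω (z − m₀) / p
-- is the motion. For arbitrary d ≥ 1 treat the prime factors of d one after another, rescaling by 1/p in between.
--
-- (ii) Let m₀, m₁ ∈ M be at distance K > 0 and u = m₁ − m₀. For m ∈ M and v = m − m₀ both coordinates of 2 ū v are
-- integers: the real part by polarization, the imaginary part because its square is one. Hence D v = (e u)(2 ū v)
-- lies in ℤ², where D = 2K²e and e is the product of the denominators of u. All distances of D (M − m₀) are
-- divisible by D, so (i) moves this set into (Dℤ)², and scaling back by 1/D gives the motion.
--
-- Both conclusions are double negations, which is what makes the case distinctions on M admissible.
module Submission where

open import Defs
import Algebra.Properties.CommutativeSemigroup as CommutativeSemigroupProperties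
open import Data.Fin as Fin using (Fin; toℕ)
import Data.Fin.Properties as Fin
open import Data.Integer as ℤ using (ℤ; +_; -[1+_])
import Data.Integer.Base
import Data.Integer.DivMod as ℤP
open import Data.Integer.Divisibility.Signed as ℤ∣ using (_∣_; divides)
import Data.Integer.Properties as ℤP
import Data.Integer.Tactic.RingSolver as ℤSolver
open import Data.List.Base using (_∷_; [])
open import Data.List.Relation.Unary.All as All using (All)
open import Data.Nat as ℕ using (ℕ; zero; suc)
import Data.Nat.Coprimality as Coprime
open import Data.Nat.Divisibility as ℕ∣ using () renaming (_∣_ to _∣ℕ_)
open import Data.Nat.ListAction using (product)
open import Data.Nat.Primality using (Prime; prime⇒nonZero; prime⇒irreducible; ¬prime[1]; euclidsLemma; prime[2]; irreducible[2])
open import Data.Nat.Primality.Factorisation using (factorise; PrimeFactorisation)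
import Data.Nat.Properties as ℕ
open import Data.Nat.Tactic.RingSolver using () renaming (solve to ℕ-solve)
open import Data.Product using (Σ; _×_; _,_; proj₁; proj₂)
open import Data.Rational as ℚ using (ℚ; 0ℚ; 1ℚ; mkℚ; ↥_; ↧_; ↧ₙ_; toℚᵘ)
import Data.Rational.Base
import Data.Rational.Properties as ℚP
open import Data.Rational.Unnormalised as ℚᵘ using (mkℚᵘ; *≡*) renaming (_≃_ to _≃ᵘ_)
import Data.Rational.Unnormalised.Properties as ℚᵘ
open import Data.Sum as Sum using (_⊎_; inj₁; inj₂)
open import Effect.Monad using (RawMonad)
open import Function.Base using (_∘_)
open import Level using (0ℓ)
open import Relation.Binary.PropositionalEquality
open import Relation.Nullary using (¬_; yes; no; contradiction; dec⇒maybe)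
open import Relation.Nullary.Decidable using (¬¬-excluded-middle)
open import Relation.Nullary.Negation using (¬¬-Monad)
import Tactic.RingSolver as RingSolver
import Tactic.RingSolver.Core.AlmostCommutativeRing as ACR

ringℚ : ACR.AlmostCommutativeRing 0ℓ 0ℓ
ringℚ = ACR.fromCommutativeRing ℚP.+-*-commutativeRing (λ x → dec⇒maybe (0ℚ ℚP.≟ x))

-- ιℤ z is fromℚᵘ (mkℚᵘ z 0) by definition, so arithmetic facts about ιℤ are checked in ℚᵘ.
toℚᵘ-ιℤ : ∀ z → toℚᵘ (ιℤ z) ≃ᵘ mkℚᵘ z 0
toℚᵘ-ιℤ z = ℚP.toℚᵘ-fromℚᵘ (mkℚᵘ z 0)

ιℤ-injective : ∀ {a b} → ιℤ a ≡ ιℤ b → a ≡ b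
ιℤ-injective {a} {b} eq with ℚᵘ.≃-trans (ℚᵘ.≃-sym (toℚᵘ-ιℤ a)) (ℚᵘ.≃-trans (ℚP.toℚᵘ-cong eq) (toℚᵘ-ιℤ b))
... | *≡* a*1≡b*1 = trans (sym (ℤP.*-identityʳ a)) (trans a*1≡b*1 (ℤP.*-identityʳ b))

module _ where
  open ℚᵘ.≃-Reasoning

  ιℤ-+ : ∀ a b → ιℤ (a ℤ.+ b) ≡ ιℤ a ℚ.+ ιℤ b
  ιℤ-+ a b = ℚP.toℚᵘ-injective (begin
    toℚᵘ (ιℤ (a ℤ.+ b))                ≈⟨ toℚᵘ-ιℤ (a ℤ.+ b) ⟩
    mkℚᵘ (a ℤ.+ b) 0                   ≈⟨ ℚᵘ.≃-reflexive (cong₂ (λ x y → mkℚᵘ (x ℤ.+ y) 0) (sym (ℤP.*-identityʳ a)) (sym (ℤP.*-identityʳ b))) ⟩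
    mkℚᵘ a 0 ℚᵘ.+ mkℚᵘ b 0             ≈⟨ ℚᵘ.+-cong (toℚᵘ-ιℤ a) (toℚᵘ-ιℤ b) ⟨
    toℚᵘ (ιℤ a) ℚᵘ.+ toℚᵘ (ιℤ b)       ≈⟨ ℚP.toℚᵘ-homo-+ (ιℤ a) (ιℤ b) ⟨
    toℚᵘ (ιℤ a ℚ.+ ιℤ b)               ∎)

  ιℤ-* : ∀ a b → ιℤ (a ℤ.* b) ≡ ιℤ a ℚ.* ιℤ b
  ιℤ-* a b = ℚP.toℚᵘ-injective (begin
    toℚᵘ (ιℤ (a ℤ.* b))                ≈⟨ toℚᵘ-ιℤ (a ℤ.* b) ⟩
    mkℚᵘ a 0 ℚᵘ.* mkℚᵘ b 0             ≈⟨ ℚᵘ.*-cong (toℚᵘ-ιℤ a) (toℚᵘ-ιℤ b) ⟨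
    toℚᵘ (ιℤ a) ℚᵘ.* toℚᵘ (ιℤ b)       ≈⟨ ℚP.toℚᵘ-homo-* (ιℤ a) (ιℤ b) ⟨
    toℚᵘ (ιℤ a ℚ.* ιℤ b)               ∎)

  ιℤ-neg : ∀ a → ιℤ (ℤ.- a) ≡ ℚ.- ιℤ a
  ιℤ-neg a = ℚP.toℚᵘ-injective (begin
    toℚᵘ (ιℤ (ℤ.- a))        ≈⟨ toℚᵘ-ιℤ (ℤ.- a) ⟩
    ℚᵘ.- mkℚᵘ a 0            ≈⟨ ℚᵘ.-‿cong (toℚᵘ-ιℤ a) ⟨
    ℚᵘ.- toℚᵘ (ιℤ a)         ≈⟨ ℚP.toℚᵘ-homo‿- (ιℤ a) ⟨
    toℚᵘ (ℚ.- ιℤ a)          ∎)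

  /-inverseˡ : ∀ n .{{_ : ℕ.NonZero n}} → (+ 1 ℚ./ n) ℚ.* ιℤ (+ n) ≡ 1ℚ
  /-inverseˡ (suc m) = ℚP.toℚᵘ-injective (begin
    toℚᵘ ((+ 1 ℚ./ suc m) ℚ.* ιℤ (+ suc m))          ≈⟨ ℚP.toℚᵘ-homo-* (+ 1 ℚ./ suc m) (ιℤ (+ suc m)) ⟩
    toℚᵘ (+ 1 ℚ./ suc m) ℚᵘ.* toℚᵘ (ιℤ (+ suc m))    ≈⟨ ℚᵘ.*-cong (ℚP.toℚᵘ-fromℚᵘ (mkℚᵘ (+ 1) m)) (toℚᵘ-ιℤ (+ suc m)) ⟩
    mkℚᵘ (+ 1) m ℚᵘ.* mkℚᵘ (+ suc m) 0               ≈⟨ *≡* (cong +_ (ℕ-solve (m ∷ []))) ⟩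
    mkℚᵘ (+ 1) 0                                      ≈⟨ toℚᵘ-ιℤ (+ 1) ⟨
    toℚᵘ 1ℚ                                           ∎)

  ↧-clears : ∀ r → ιℤ (↧ r) ℚ.* r ≡ ιℤ (↥ r)
  ↧-clears r@(mkℚ n d _) = ℚP.toℚᵘ-injective (begin
    toℚᵘ (ιℤ (↧ r) ℚ.* r)          ≈⟨ ℚP.toℚᵘ-homo-* (ιℤ (↧ r)) r ⟩
    toℚᵘ (ιℤ (↧ r)) ℚᵘ.* mkℚᵘ n d  ≈⟨ ℚᵘ.*-congʳ (toℚᵘ-ιℤ (↧ r)) ⟩
    mkℚᵘ (↧ r) 0 ℚᵘ.* mkℚᵘ n d     ≈⟨ *≡* (trans (ℤP.*-identityʳ _) (trans (ℤP.*-comm (↧ r) n) (cong (λ k → n ℤ.* + suc k) (sym (ℕ.+-identityʳ d))))) ⟩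
    mkℚᵘ n 0                       ≈⟨ toℚᵘ-ιℤ n ⟨
    toℚᵘ (ιℤ n)                    ∎)

ιℤ-- : ∀ a b → ιℤ (a ℤ.- b) ≡ ιℤ a ℚ.- ιℤ b
ιℤ-- a b = trans (ιℤ-+ a (ℤ.- b)) (cong (ιℤ a ℚ.+_) (ιℤ-neg b))

ιℤ-pos-* : ∀ m n → ιℤ (+ (m ℕ.* n)) ≡ ιℤ (+ m) ℚ.* ιℤ (+ n)
ιℤ-pos-* m n = trans (cong ιℤ (ℤP.pos-* m n)) (ιℤ-* (+ m) (+ n))

/-inverseʳ : ∀ n .{{_ : ℕ.NonZero n}} → ιℤ (+ n) ℚ.* (+ 1 ℚ./ n) ≡ 1ℚ
/-inverseʳ n = trans (ℚP.*-comm (ιℤ (+ n)) (+ 1 ℚ./ n)) (/-inverseˡ n)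

square-integral⇒integral : ∀ r n → r ℚ.* r ≡ ιℤ n → r ≡ ιℤ (↥ r)
square-integral⇒integral r@(mkℚ a d a⊥d) n r²≡n = r≡a (ℕ.suc-injective (coprime (d+1∣∣a∣ , ℕ∣.∣-refl)))
  where
  coprime : Coprime.Coprime ℤ.∣ a ∣ (suc d)
  coprime = Coprime.recompute a⊥d
  a²≡n[d+1]² : (a ℤ.* a) ℤ.* + 1 ≡ n ℤ.* + (suc d ℕ.* suc d)
  a²≡n[d+1]² with ℚᵘ.≃-trans (ℚᵘ.≃-sym (ℚP.toℚᵘ-homo-* r r)) (ℚᵘ.≃-trans (ℚP.toℚᵘ-cong r²≡n) (toℚᵘ-ιℤ n))
  ... | *≡* eq = eq
  ∣a∣²≡∣n∣[d+1]² : ℤ.∣ a ∣ ℕ.* ℤ.∣ a ∣ ≡ (ℤ.∣ n ∣ ℕ.* suc d) ℕ.* suc d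
  ∣a∣²≡∣n∣[d+1]² = begin
    ℤ.∣ a ∣ ℕ.* ℤ.∣ a ∣                      ≡⟨ ℤP.abs-* a a ⟨
    ℤ.∣ a ℤ.* a ∣                            ≡⟨ cong ℤ.∣_∣ (trans (sym (ℤP.*-identityʳ (a ℤ.* a))) a²≡n[d+1]²) ⟩
    ℤ.∣ n ℤ.* + (suc d ℕ.* suc d) ∣          ≡⟨ ℤP.abs-* n (+ (suc d ℕ.* suc d)) ⟩
    ℤ.∣ n ∣ ℕ.* (suc d ℕ.* suc d)            ≡⟨ ℕ.*-assoc ℤ.∣ n ∣ (suc d) (suc d) ⟨
    (ℤ.∣ n ∣ ℕ.* suc d) ℕ.* suc d            ∎
    where open ≡-Reasoning
  d+1∣∣a∣ : suc d ∣ℕ ℤ.∣ a ∣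
  d+1∣∣a∣ = Coprime.coprime-divisor (Coprime.sym coprime) (ℕ∣.divides (ℤ.∣ n ∣ ℕ.* suc d) ∣a∣²≡∣n∣[d+1]²)
  r≡a : d ≡ 0 → r ≡ ιℤ a
  r≡a refl = sym (ℚP.toℚᵘ-injective (toℚᵘ-ιℤ a))

0≤square : ∀ r → 0ℚ ℚ.≤ r ℚ.* r
0≤square r@(mkℚ (+ _) _ _)    = ℚP.nonNegative⁻¹ _ {{ℚP.nonNeg*nonNeg⇒nonNeg r r}}
0≤square r@(mkℚ -[1+ _ ] _ _) = ℚP.nonNegative⁻¹ _ {{ℚP.nonPos*nonPos⇒nonPos r r}}

sum-of-squares≡0⇒≡0 : ∀ a b → a ℚ.* a ℚ.+ b ℚ.* b ≡ 0ℚ → a ≡ 0ℚ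
sum-of-squares≡0⇒≡0 a b a²+b²≡0 = ℚP.↥p≡0⇒p≡0 a ↥a≡0
  where
  a²≡0 : a ℚ.* a ≡ 0ℚ
  a²≡0 = ℚP.≤-antisym (begin
    a ℚ.* a                    ≡⟨ ℚP.+-identityʳ (a ℚ.* a) ⟨
    a ℚ.* a ℚ.+ 0ℚ             ≤⟨ ℚP.+-monoʳ-≤ (a ℚ.* a) (0≤square b) ⟩
    a ℚ.* a ℚ.+ b ℚ.* b        ≡⟨ a²+b²≡0 ⟩
    0ℚ                         ∎) (0≤square a)
    where open ℚP.≤-Reasoning
  multiple-of-0 : ∀ {x g y} → x ℤ.* g ≡ y → x ≡ + 0 → y ≡ + 0
  multiple-of-0 {g = g} refl refl = ℤP.*-zeroˡ g
  ↥a≡0 : ↥ a ≡ + 0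
  ↥a≡0 = Sum.reduce (ℤP.i*j≡0⇒i≡0∨j≡0 (↥ a) (multiple-of-0 (ℚP.↥-* a a) (cong ↥_ a²≡0)))

-- Gaussian integers and Gaussian rationals

module ℤ² where
  infixl 6 _-_
  infixl 7 _*_ _·_

  _-_ : ℤ² → ℤ² → ℤ²
  (a , b) - (c , d) = (a ℤ.- c , b ℤ.- d)

  _*_ : ℤ² → ℤ² → ℤ²
  (a , b) * (c , d) = (a ℤ.* c ℤ.- b ℤ.* d , b ℤ.* c ℤ.+ a ℤ.* d)

  _·_ : ℤ → ℤ² → ℤ²
  k · (a , b) = (k ℤ.* a , k ℤ.* b)

  norm : ℤ² → ℤ
  norm (a , b) = a ℤ.* a ℤ.+ b ℤ.* b

  conj : ℤ² → ℤ²
  conj (a , b) = (a , ℤ.- b)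

module ℚ² where
  infixl 6 _-_
  infixl 7 _*_ _·_

  _-_ : ℚ² → ℚ² → ℚ²
  (a , b) - (c , d) = (a ℚ.- c , b ℚ.- d)

  _*_ : ℚ² → ℚ² → ℚ²
  (a , b) * (c , d) = (a ℚ.* c ℚ.- b ℚ.* d , b ℚ.* c ℚ.+ a ℚ.* d)

  _·_ : ℚ → ℚ² → ℚ²
  k · (a , b) = (k ℚ.* a , k ℚ.* b)

  norm : ℚ² → ℚ
  norm (a , b) = a ℚ.* a ℚ.+ b ℚ.* b

  conj : ℚ² → ℚ²
  conj (a , b) = (a , ℚ.- b)

infix 4 _∣²_
_∣²_ : ℤ → ℤ² → Set
k ∣² (a , b) = k ∣ a × k ∣ b

norm-* : ∀ z w → ℤ².norm (z ℤ².* w) ≡ ℤ².norm z ℤ.* ℤ².norm w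
norm-* (a , b) (c , d) = brahmagupta a b c d
  where
  open Data.Integer.Base using (_+_; _*_; _-_; -_)
  brahmagupta : ∀ a b c d → (a * c - b * d) * (a * c - b * d) + (b * c + a * d) * (b * c + a * d)
                          ≡ (a * a + b * b) * (c * c + d * d)
  brahmagupta = ℤSolver.solve-∀

norm-conj : ∀ z → ℤ².norm (ℤ².conj z) ≡ ℤ².norm z
norm-conj (a , b) = identity a b
  where
  open Data.Integer.Base using (_+_; _*_; _-_; -_)
  identity : ∀ a b → a * a + - b * - b ≡ a * a + b * b
  identity = ℤSolver.solve-∀

*-·-comm : ∀ z k w → z ℤ².* (k ℤ².· w) ≡ k ℤ².· (z ℤ².* w)
*-·-comm (a , b) k (c , d) = cong₂ _,_ (identity₁ a b k c d) (identity₂ a b k c d)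
  where
  open Data.Integer.Base using (_+_; _*_; _-_; -_)
  identity₁ : ∀ a b k c d → a * (k * c) - b * (k * d) ≡ k * (a * c - b * d)
  identity₁ = ℤSolver.solve-∀
  identity₂ : ∀ a b k c d → b * (k * c) + a * (k * d) ≡ k * (b * c + a * d)
  identity₂ = ℤSolver.solve-∀

*-conj-*≡norm-· : ∀ z w → z ℤ².* (ℤ².conj z ℤ².* w) ≡ ℤ².norm z ℤ².· w
*-conj-*≡norm-· (a , b) (c , d) = cong₂ _,_ (identity₁ a b c d) (identity₂ a b c d)
  where
  open Data.Integer.Base using (_+_; _*_; _-_; -_)
  identity₁ : ∀ a b c d → a * (a * c - - b * d) - b * (- b * c + a * d) ≡ (a * a + b * b) * c
  identity₁ = ℤSolver.solve-∀
  identity₂ : ∀ a b c d → b * (a * c - - b * d) + a * (- b * c + a * d) ≡ (a * a + b * b) * d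
  identity₂ = ℤSolver.solve-∀

conj²-*≡norm-·-conj : ∀ z w → (ℤ².conj z ℤ².* ℤ².conj z) ℤ².* (z ℤ².* w) ≡ ℤ².norm z ℤ².· (ℤ².conj z ℤ².* w)
conj²-*≡norm-·-conj (a , b) (c , d) = cong₂ _,_ (identity₁ a b c d) (identity₂ a b c d)
  where
  open Data.Integer.Base using (_+_; _*_; _-_; -_)
  identity₁ : ∀ a b c d → (a * a - - b * - b) * (a * c - b * d) - (- b * a + a * - b) * (b * c + a * d)
                        ≡ (a * a + b * b) * (a * c - - b * d)
  identity₁ = ℤSolver.solve-∀
  identity₂ : ∀ a b c d → (- b * a + a * - b) * (a * c - b * d) + (a * a - - b * - b) * (b * c + a * d)
                        ≡ (a * a + b * b) * (- b * c + a * d)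
  identity₂ = ℤSolver.solve-∀

product-of-imaginary-parts : ∀ π w → proj₂ (ℤ².conj π ℤ².* w) ℤ.* proj₂ (π ℤ².* w)
                             ≡ proj₁ π ℤ.* proj₁ π ℤ.* ℤ².norm w ℤ.- ℤ².norm π ℤ.* (proj₁ w ℤ.* proj₁ w)
product-of-imaginary-parts (a , b) (c , d) = identity a b c d
  where
  open Data.Integer.Base using (_+_; _*_; _-_; -_)
  identity : ∀ a b c d → (- b * c + a * d) * (b * c + a * d) ≡ a * a * (c * c + d * d) - (a * a + b * b) * (c * c)
  identity = ℤSolver.solve-∀

·-cancelˡ : ∀ k .{{_ : ℤ.NonZero k}} {z w} → k ℤ².· z ≡ k ℤ².· w → z ≡ w
·-cancelˡ k {_ , _} {_ , _} eq = cong₂ _,_ (ℤP.*-cancelˡ-≡ k _ _ (cong proj₁ eq)) (ℤP.*-cancelˡ-≡ k _ _ (cong proj₂ eq))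

·-assoc : ∀ k l z → k ℤ².· (l ℤ².· z) ≡ (k ℤ.* l) ℤ².· z
·-assoc k l (a , b) = cong₂ _,_ (sym (ℤP.*-assoc k l a)) (sym (ℤP.*-assoc k l b))

norm-·-difference : ∀ k z w → ℤ².norm (k ℤ².· z ℤ².- k ℤ².· w) ≡ (k ℤ.* k) ℤ.* ℤ².norm (z ℤ².- w)
norm-·-difference k (a , b) (c , d) = identity k a b c d
  where
  open Data.Integer.Base using (_+_; _*_; _-_; -_)
  identity : ∀ k a b c d → (k * a - k * c) * (k * a - k * c) + (k * b - k * d) * (k * b - k * d)
                         ≡ (k * k) * ((a - c) * (a - c) + (b - d) * (b - d))
  identity = ℤSolver.solve-∀

∣²⇒≡· : ∀ {k} z → k ∣² z → Σ ℤ² λ w → z ≡ k ℤ².· w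
∣²⇒≡· {k} (_ , _) (divides a refl , divides b refl) = (a , b) , cong₂ _,_ (ℤP.*-comm a k) (ℤP.*-comm b k)

∣²⇒∣²· : ∀ {k} c z → k ∣² z → k ∣² c ℤ².· z
∣²⇒∣²· c (_ , _) (k∣a , k∣b) = ℤ∣.∣n⇒∣m*n c k∣a , ℤ∣.∣n⇒∣m*n c k∣b

∣⇒∣²· : ∀ {k c} z → k ∣ c → k ∣² c ℤ².· z
∣⇒∣²· (a , b) k∣c = ℤ∣.∣m⇒∣m*n a k∣c , ℤ∣.∣m⇒∣m*n b k∣c

∣²⇒*∣²· : ∀ {k} z → k ∣² z → k ℤ.* k ∣² k ℤ².· z
∣²⇒*∣²· {k} (_ , _) (k∣a , k∣b) = ℤ∣.*-monoʳ-∣ k k∣a , ℤ∣.*-monoʳ-∣ k k∣b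

∣²-∣²⇒∣²- : ∀ {k} z w → k ∣² z → k ∣² w → k ∣² z ℤ².- w
∣²-∣²⇒∣²- (_ , _) (_ , _) (k∣a , k∣b) (k∣c , k∣d) = ℤ∣.∣m∣n⇒∣m-n k∣a k∣c , ℤ∣.∣m∣n⇒∣m-n k∣b k∣d

ι²-- : ∀ z w → ι² (z ℤ².- w) ≡ ι² z ℚ².- ι² w
ι²-- (a , b) (c , d) = cong₂ _,_ (ιℤ-- a c) (ιℤ-- b d)

ι²-* : ∀ z w → ι² (z ℤ².* w) ≡ ι² z ℚ².* ι² w
ι²-* (a , b) (c , d) = cong₂ _,_
  (trans (ιℤ-- (a ℤ.* c) (b ℤ.* d)) (cong₂ ℚ._-_ (ιℤ-* a c) (ιℤ-* b d)))
  (trans (ιℤ-+ (b ℤ.* c) (a ℤ.* d)) (cong₂ ℚ._+_ (ιℤ-* b c) (ιℤ-* a d)))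

ι²-· : ∀ k z → ι² (k ℤ².· z) ≡ ιℤ k ℚ².· ι² z
ι²-· k (a , b) = cong₂ _,_ (ιℤ-* k a) (ιℤ-* k b)

ιℤ-norm : ∀ z → ιℤ (ℤ².norm z) ≡ ℚ².norm (ι² z)
ιℤ-norm (a , b) = trans (ιℤ-+ (a ℤ.* a) (b ℤ.* b)) (cong₂ ℚ._+_ (ιℤ-* a a) (ιℤ-* b b))

ι²-unscale : ∀ n .{{_ : ℕ.NonZero n}} z → (+ 1 ℚ./ n) ℚ².· ι² (+ n ℤ².· z) ≡ ι² z
ι²-unscale n (a , b) = cong₂ _,_ (unscale a) (unscale b)
  where
  open ≡-Reasoning
  unscale : ∀ a → (+ 1 ℚ./ n) ℚ.* ιℤ (+ n ℤ.* a) ≡ ιℤ a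
  unscale a = begin
    (+ 1 ℚ./ n) ℚ.* ιℤ (+ n ℤ.* a)          ≡⟨ cong ((+ 1 ℚ./ n) ℚ.*_) (ιℤ-* (+ n) a) ⟩
    (+ 1 ℚ./ n) ℚ.* (ιℤ (+ n) ℚ.* ιℤ a)     ≡⟨ ℚP.*-assoc (+ 1 ℚ./ n) (ιℤ (+ n)) (ιℤ a) ⟨
    ((+ 1 ℚ./ n) ℚ.* ιℤ (+ n)) ℚ.* ιℤ a     ≡⟨ cong (ℚ._* ιℤ a) (/-inverseˡ n) ⟩
    1ℚ ℚ.* ιℤ a                             ≡⟨ ℚP.*-identityˡ (ιℤ a) ⟩
    ιℤ a                                    ∎

norm≡0⇒≡0 : ∀ z → ℚ².norm z ≡ 0ℚ → z ≡ (0ℚ , 0ℚ)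
norm≡0⇒≡0 (a , b) a²+b²≡0 =
  cong₂ _,_ (sum-of-squares≡0⇒≡0 a b a²+b²≡0) (sum-of-squares≡0⇒≡0 b a (trans (ℚP.+-comm (b ℚ.* b) (a ℚ.* a)) a²+b²≡0))

dist²-ι² : ∀ z w → dist²ℚ (ι² z) (ι² w) ≡ ιℤ (ℤ².norm (z ℤ².- w))
dist²-ι² z w = trans (cong ℚ².norm (sym (ι²-- z w))) (sym (ιℤ-norm (z ℤ².- w)))

DistIs-ι²⇒norm : ∀ {x y k} → DistIs (ι² x) (ι² y) k → + (k ℕ.* k) ≡ ℤ².norm (x ℤ².- y)
DistIs-ι²⇒norm {x} {y} d = ιℤ-injective (trans d (dist²-ι² x y))

norm⇒DistIs-ι² : ∀ {x y k} → + (k ℕ.* k) ≡ ℤ².norm (x ℤ².- y) → DistIs (ι² x) (ι² y) k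
norm⇒DistIs-ι² {x} {y} e = trans (cong ιℤ e) (sym (dist²-ι² x y))

pos-square-* : ∀ m k → + ((m ℕ.* k) ℕ.* (m ℕ.* k)) ≡ (+ m ℤ.* + m) ℤ.* + (k ℕ.* k)
pos-square-* m k = begin
  + ((m ℕ.* k) ℕ.* (m ℕ.* k))          ≡⟨ ℤP.pos-* (m ℕ.* k) (m ℕ.* k) ⟩
  + (m ℕ.* k) ℤ.* + (m ℕ.* k)          ≡⟨ cong₂ ℤ._*_ (ℤP.pos-* m k) (ℤP.pos-* m k) ⟩
  (+ m ℤ.* + k) ℤ.* (+ m ℤ.* + k)      ≡⟨ interchange (+ m) (+ k) (+ m) (+ k) ⟩
  (+ m ℤ.* + m) ℤ.* (+ k ℤ.* + k)      ≡⟨ cong ((+ m ℤ.* + m) ℤ.*_) (ℤP.pos-* k k) ⟨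
  (+ m ℤ.* + m) ℤ.* + (k ℕ.* k)        ∎
  where
  open ≡-Reasoning
  open CommutativeSemigroupProperties ℤP.*-commutativeSemigroup using (interchange)

DistIs-isMotion : ∀ {T x y k} → IsMotion T → DistIs x y k → DistIs (T x) (T y) k
DistIs-isMotion {x = x} {y} T-isMotion d = trans d (sym (T-isMotion x y))

DistIs-unscale : ∀ m .{{_ : ℕ.NonZero m}} z w k → DistIs (ι² (+ m ℤ².· z)) (ι² (+ m ℤ².· w)) (m ℕ.* k) → DistIs (ι² z) (ι² w) k
DistIs-unscale m z w k d = norm⇒DistIs-ι² {z} {w} {k} (ℤP.*-cancelˡ-≡ (+ m ℤ.* + m) _ _ {{ℤP.i*j≢0 (+ m) (+ m)}} (begin
  (+ m ℤ.* + m) ℤ.* + (k ℕ.* k)                ≡⟨ pos-square-* m k ⟨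
  + ((m ℕ.* k) ℕ.* (m ℕ.* k))                  ≡⟨ DistIs-ι²⇒norm {+ m ℤ².· z} {+ m ℤ².· w} {m ℕ.* k} d ⟩
  ℤ².norm (+ m ℤ².· z ℤ².- + m ℤ².· w)         ≡⟨ norm-·-difference (+ m) z w ⟩
  (+ m ℤ.* + m) ℤ.* ℤ².norm (z ℤ².- w)         ∎))
  where open ≡-Reasoning

record IsSimilarity (c : ℚ) (f : ℚ² → ℚ²) : Set where
  constructor mkSimilarity
  field
    dist²-scaled : ∀ x y → dist²ℚ (f x) (f y) ≡ c ℚ.* dist²ℚ x y

translate-isMotion : ∀ c → IsMotion (ℚ²._- c)
translate-isMotion (c₁ , c₂) (x₁ , x₂) (y₁ , y₂) = cong₂ (λ a b → a ℚ.* a ℚ.+ b ℚ.* b) (cancel x₁ y₁ c₁) (cancel x₂ y₂ c₂)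
  where
  open Data.Rational.Base using (_+_; _*_; _-_; -_)
  cancel : ∀ a b c → (a - c) - (b - c) ≡ a - b
  cancel = RingSolver.solve-∀ ringℚ

scale-isSimilarity : ∀ t → IsSimilarity (t ℚ.* t) (t ℚ².·_)
scale-isSimilarity t = mkSimilarity λ x y → identity t (proj₁ x) (proj₂ x) (proj₁ y) (proj₂ y)
  where
  open Data.Rational.Base using (_+_; _*_; _-_; -_)
  identity : ∀ t x₁ x₂ y₁ y₂ → (t * x₁ - t * y₁) * (t * x₁ - t * y₁) + (t * x₂ - t * y₂) * (t * x₂ - t * y₂)
                             ≡ (t * t) * ((x₁ - y₁) * (x₁ - y₁) + (x₂ - y₂) * (x₂ - y₂))
  identity = RingSolver.solve-∀ ringℚ

mul-isSimilarity : ∀ w → IsSimilarity (ℚ².norm w) (w ℚ².*_)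
mul-isSimilarity (a , b) = mkSimilarity λ x y → identity a b (proj₁ x) (proj₂ x) (proj₁ y) (proj₂ y)
  where
  open Data.Rational.Base using (_+_; _*_; _-_; -_)
  identity : ∀ a b x₁ x₂ y₁ y₂ →
    ((a * x₁ - b * x₂) - (a * y₁ - b * y₂)) * ((a * x₁ - b * x₂) - (a * y₁ - b * y₂))
      + ((b * x₁ + a * x₂) - (b * y₁ + a * y₂)) * ((b * x₁ + a * x₂) - (b * y₁ + a * y₂))
    ≡ (a * a + b * b) * ((x₁ - y₁) * (x₁ - y₁) + (x₂ - y₂) * (x₂ - y₂))
  identity = RingSolver.solve-∀ ringℚ

∘-isSimilarity : ∀ {c d f g} → IsSimilarity c f → IsSimilarity d g → IsSimilarity (c ℚ.* d) (λ z → f (g z))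
∘-isSimilarity {c} {d} {g = g} (mkSimilarity f-sim) (mkSimilarity g-sim) = mkSimilarity λ x y →
  trans (f-sim (g x) (g y)) (trans (cong (c ℚ.*_) (g-sim x y)) (sym (ℚP.*-assoc c d (dist²ℚ x y))))

isMotion⇒isSimilarity : ∀ {f} → IsMotion f → IsSimilarity 1ℚ f
isMotion⇒isSimilarity f-mot = mkSimilarity λ x y → trans (f-mot x y) (sym (ℚP.*-identityˡ (dist²ℚ x y)))

isSimilarity⇒isMotion : ∀ {c f} → c ≡ 1ℚ → IsSimilarity c f → IsMotion f
isSimilarity⇒isMotion refl (mkSimilarity f-sim) x y = trans (f-sim x y) (ℚP.*-identityˡ (dist²ℚ x y))

square-* : ∀ a b → (a ℚ.* a) ℚ.* (b ℚ.* b) ≡ (a ℚ.* b) ℚ.* (a ℚ.* b)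
square-* = RingSolver.solve-∀ ringℚ

conjugate-isMotion : ∀ T s t → s ℚ.* t ≡ 1ℚ → IsMotion T → IsMotion (λ z → s ℚ².· T (t ℚ².· z))
conjugate-isMotion T s t st≡1 T-mot = isSimilarity⇒isMotion factor≡1
  (∘-isSimilarity (scale-isSimilarity s) (∘-isSimilarity (isMotion⇒isSimilarity {T} T-mot) (scale-isSimilarity t)))
  where
  open ≡-Reasoning
  factor≡1 : (s ℚ.* s) ℚ.* (1ℚ ℚ.* (t ℚ.* t)) ≡ 1ℚ
  factor≡1 = begin
    (s ℚ.* s) ℚ.* (1ℚ ℚ.* (t ℚ.* t))  ≡⟨ cong ((s ℚ.* s) ℚ.*_) (ℚP.*-identityˡ (t ℚ.* t)) ⟩
    (s ℚ.* s) ℚ.* (t ℚ.* t)           ≡⟨ square-* s t ⟩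
    (s ℚ.* t) ℚ.* (s ℚ.* t)           ≡⟨ cong₂ ℚ._*_ st≡1 st≡1 ⟩
    1ℚ ℚ.* 1ℚ                         ≡⟨⟩
    1ℚ                                ∎

rotation-isMotion : ∀ p .{{_ : ℕ.NonZero p}} ω → ℤ².norm ω ≡ + p ℤ.* + p →
                    IsMotion (λ z → (+ 1 ℚ./ p) ℚ².· (ι² ω ℚ².* z))
rotation-isMotion p ω ∣ω∣²≡p² = isSimilarity⇒isMotion factor≡1
  (∘-isSimilarity (scale-isSimilarity q) (mul-isSimilarity (ι² ω)))
  where
  open ≡-Reasoning
  q = + 1 ℚ./ p
  ∣ιω∣²≡p² : ℚ².norm (ι² ω) ≡ ιℤ (+ p) ℚ.* ιℤ (+ p)
  ∣ιω∣²≡p² = trans (sym (ιℤ-norm ω)) (trans (cong ιℤ ∣ω∣²≡p²) (ιℤ-* (+ p) (+ p)))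
  factor≡1 : (q ℚ.* q) ℚ.* ℚ².norm (ι² ω) ≡ 1ℚ
  factor≡1 = begin
    (q ℚ.* q) ℚ.* ℚ².norm (ι² ω)                 ≡⟨ cong ((q ℚ.* q) ℚ.*_) ∣ιω∣²≡p² ⟩
    (q ℚ.* q) ℚ.* (ιℤ (+ p) ℚ.* ιℤ (+ p))        ≡⟨ square-* q (ιℤ (+ p)) ⟩
    (q ℚ.* ιℤ (+ p)) ℚ.* (q ℚ.* ιℤ (+ p))        ≡⟨ cong₂ ℚ._*_ (/-inverseˡ p) (/-inverseˡ p) ⟩
    1ℚ ℚ.* 1ℚ                                    ≡⟨⟩
    1ℚ                                           ∎

DistIs-scale : ∀ d {x y k} → DistIs x y k → DistIs (ιℤ (+ d) ℚ².· x) (ιℤ (+ d) ℚ².· y) (d ℕ.* k)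
DistIs-scale d {x} {y} {k} dist-k = begin
  ιℤ (+ ((d ℕ.* k) ℕ.* (d ℕ.* k)))                    ≡⟨ cong ιℤ (pos-square-* d k) ⟩
  ιℤ ((+ d ℤ.* + d) ℤ.* + (k ℕ.* k))                  ≡⟨ trans (ιℤ-* (+ d ℤ.* + d) (+ (k ℕ.* k))) (cong (ℚ._* _) (ιℤ-* (+ d) (+ d))) ⟩
  (ιℤ (+ d) ℚ.* ιℤ (+ d)) ℚ.* ιℤ (+ (k ℕ.* k))        ≡⟨ cong ((ιℤ (+ d) ℚ.* ιℤ (+ d)) ℚ.*_) dist-k ⟩
  (ιℤ (+ d) ℚ.* ιℤ (+ d)) ℚ.* dist²ℚ x y               ≡⟨ IsSimilarity.dist²-scaled (scale-isSimilarity (ιℤ (+ d))) x y ⟨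
  dist²ℚ (ιℤ (+ d) ℚ².· x) (ιℤ (+ d) ℚ².· y)          ∎
  where open ≡-Reasoning

-- Elementary number theory

floor-sqrt : ∀ n → Σ ℕ λ m → m ℕ.* m ℕ.≤ n × n ℕ.< suc m ℕ.* suc m
floor-sqrt zero = 0 , ℕ.z≤n , ℕ.s≤s ℕ.z≤n
floor-sqrt (suc n) with floor-sqrt n
... | m , m²≤n , n<[1+m]² with suc n ℕ.<? suc m ℕ.* suc m
...   | yes 1+n<[1+m]² = m , ℕ.m≤n⇒m≤1+n m²≤n , 1+n<[1+m]²
...   | no  1+n≮[1+m]² = suc m , ℕ.≤-reflexive (sym 1+n≡[1+m]²) , subst (ℕ._< suc (suc m) ℕ.* suc (suc m)) (sym 1+n≡[1+m]²) [1+m]²<[2+m]²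
  where
  1+n≡[1+m]² : suc n ≡ suc m ℕ.* suc m
  1+n≡[1+m]² = ℕ.≤-antisym n<[1+m]² (ℕ.≮⇒≥ 1+n≮[1+m]²)
  [1+m]²<[2+m]² : suc m ℕ.* suc m ℕ.< suc (suc m) ℕ.* suc (suc m)
  [1+m]²<[2+m]² = ℕ.*-mono-< (ℕ.n<1+n (suc m)) (ℕ.n<1+n (suc m))

prime≢square : ∀ {p} m → Prime p → p ≢ m ℕ.* m
prime≢square {p} m p-prime p≡m² with prime⇒irreducible p-prime (ℕ∣.divides m p≡m²)
... | inj₁ refl = ¬prime[1] (subst Prime p≡m² p-prime)
... | inj₂ refl = ¬prime[1] (subst Prime (sym 1≡p) p-prime)
  where
  instance _ = prime⇒nonZero p-prime
  1≡p : 1 ≡ p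
  1≡p = ℕ.*-cancelˡ-≡ 1 p p (trans (ℕ.*-identityʳ p) p≡m²)

multiple-below-double : ∀ {p s} → p ∣ℕ s → s ≢ 0 → s ℕ.< p ℕ.+ p → s ≡ p
multiple-below-double     (ℕ∣.divides zero refl)          s≢0 _    = contradiction refl s≢0
multiple-below-double {p} (ℕ∣.divides (suc zero) refl)    _   _    = ℕ.+-identityʳ p
multiple-below-double {p} (ℕ∣.divides (suc (suc q)) refl) _   s<2p =
  contradiction s<2p (ℕ.≤⇒≯ (ℕ.+-monoʳ-≤ p (ℕ.m≤m+n p (q ℕ.* p))))

%ℕ-≡⇒∣- : ∀ d .{{_ : ℕ.NonZero d}} u w → u ℤ.%ℕ d ≡ w ℤ.%ℕ d → + d ∣ u ℤ.- w
%ℕ-≡⇒∣- d u w eq = divides (q₁ ℤ.- q₂) (begin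
  u ℤ.- w                                        ≡⟨ cong₂ ℤ._-_ (ℤP.a≡a%ℕn+[a/ℕn]*n u d) (ℤP.a≡a%ℕn+[a/ℕn]*n w d) ⟩
  (+ r₁ ℤ.+ q₁ ℤ.* + d) ℤ.- (+ r₂ ℤ.+ q₂ ℤ.* + d)  ≡⟨ cong (λ r → (+ r ℤ.+ q₁ ℤ.* + d) ℤ.- (+ r₂ ℤ.+ q₂ ℤ.* + d)) eq ⟩
  (+ r₂ ℤ.+ q₁ ℤ.* + d) ℤ.- (+ r₂ ℤ.+ q₂ ℤ.* + d)  ≡⟨ cancel-remainder (+ r₂) q₁ q₂ (+ d) ⟩
  (q₁ ℤ.- q₂) ℤ.* + d                            ∎)
  where
  open Data.Integer.Base using (_+_; _*_; _-_; -_)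
  open ≡-Reasoning
  q₁ = u ℤ./ℕ d
  q₂ = w ℤ./ℕ d
  r₁ = u ℤ.%ℕ d
  r₂ = w ℤ.%ℕ d
  cancel-remainder : ∀ r a b d → (r + a * d) - (r + b * d) ≡ (a - b) * d
  cancel-remainder = ℤSolver.solve-∀

pigeonhole-mod : ∀ {k} d .{{_ : ℕ.NonZero d}} → d ℕ.< k → (f : Fin k → ℤ) →
                 Σ (Fin k) λ i → Σ (Fin k) λ j → i ≢ j × + d ∣ f i ℤ.- f j
pigeonhole-mod d d<k f with Fin.pigeonhole d<k (λ i → Fin.fromℕ< (ℤP.n%ℕd<d (f i) d))
... | i , j , i<j , same-class = i , j , (λ i≡j → ℕ.<-irrefl (cong toℕ i≡j) i<j) ,
  %ℕ-≡⇒∣- d (f i) (f j) (trans (sym (Fin.toℕ-fromℕ< _)) (trans (cong toℕ same-class) (Fin.toℕ-fromℕ< _)))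

square≡∣∣² : ∀ a → a ℤ.* a ≡ + (ℤ.∣ a ∣ ℕ.* ℤ.∣ a ∣)
square≡∣∣² (+ n)    = sym (ℤP.pos-* n n)
square≡∣∣² -[1+ n ] = refl

ShortSolution : ℕ → ℕ → ℤ → ℤ → Set
ShortSolution d m x y = Σ ℤ λ a → Σ ℤ λ b → ¬ (a ≡ + 0 × b ≡ + 0) × ℤ.∣ a ∣ ℕ.≤ m × ℤ.∣ b ∣ ℕ.≤ m ×
                                           + d ∣ a ℤ.* y ℤ.- b ℤ.* x

box-pigeonhole : ∀ d .{{_ : ℕ.NonZero d}} m x y → d ℕ.< suc m ℕ.* suc m → ShortSolution d m x y
box-pigeonhole d m x y d<[1+m]² = collision (pigeonhole-mod d d<[1+m]² (value ∘ Fin.remQuot {N} N))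
  where
  open Data.Integer.Base using (_+_; _*_; _-_; -_)
  N = suc m
  value : Fin N × Fin N → ℤ
  value (i , j) = + toℕ i ℤ.* y ℤ.- + toℕ j ℤ.* x
  difference : ∀ i₁ j₁ i₂ j₂ → (i₁ * y - j₁ * x) - (i₂ * y - j₂ * x) ≡ (i₁ - i₂) * y - (j₁ - j₂) * x
  difference i₁ j₁ i₂ j₂ = ℤSolver.solve (i₁ ∷ j₁ ∷ i₂ ∷ j₂ ∷ x ∷ y ∷ [])
  ∣-∣≤m : ∀ (i j : Fin N) → ℤ.∣ + toℕ i ℤ.- + toℕ j ∣ ℕ.≤ m
  ∣-∣≤m i j = subst (ℕ._≤ m) (cong ℤ.∣_∣ (sym (ℤP.m-n≡m⊖n (toℕ i) (toℕ j))))
    (ℕ.≤-trans (ℤP.∣m⊝n∣≤m⊔n (toℕ i) (toℕ j)) (ℕ.⊔-lub (Fin.toℕ≤pred[n] i) (Fin.toℕ≤pred[n] j)))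
  same : ∀ (i j : Fin N) → + toℕ i ℤ.- + toℕ j ≡ + 0 → i ≡ j
  same i j eq = Fin.toℕ-injective (ℤP.+-injective (ℤP.i-j≡0⇒i≡j (+ toℕ i) (+ toℕ j) eq))
  collision : (Σ (Fin (N ℕ.* N)) λ k₁ → Σ (Fin (N ℕ.* N)) λ k₂ →
                 k₁ ≢ k₂ × + d ∣ value (Fin.remQuot {N} N k₁) ℤ.- value (Fin.remQuot {N} N k₂)) →
              ShortSolution d m x y
  collision (k₁ , k₂ , k₁≢k₂ , d∣) = + toℕ i₁ ℤ.- + toℕ i₂ , + toℕ j₁ ℤ.- + toℕ j₂ ,
    distinct , ∣-∣≤m i₁ i₂ , ∣-∣≤m j₁ j₂ , subst (+ d ∣_) (difference (+ toℕ i₁) (+ toℕ j₁) (+ toℕ i₂) (+ toℕ j₂)) d∣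
    where
    i₁ = proj₁ (Fin.remQuot {N} N k₁)
    j₁ = proj₂ (Fin.remQuot {N} N k₁)
    i₂ = proj₁ (Fin.remQuot {N} N k₂)
    j₂ = proj₂ (Fin.remQuot {N} N k₂)
    distinct : ¬ (+ toℕ i₁ ℤ.- + toℕ i₂ ≡ + 0 × + toℕ j₁ ℤ.- + toℕ j₂ ≡ + 0)
    distinct (i₁≡i₂ , j₁≡j₂) = k₁≢k₂ (begin
      k₁                                     ≡⟨ Fin.combine-remQuot {N} N k₁ ⟨
      Fin.combine i₁ j₁                      ≡⟨ cong₂ Fin.combine (same i₁ i₂ i₁≡i₂) (same j₁ j₂ j₁≡j₂) ⟩
      Fin.combine i₂ j₂                      ≡⟨ Fin.combine-remQuot {N} N k₂ ⟩
      k₂                                     ∎)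
      where open ≡-Reasoning

*-pres-∣ : ∀ {i j a b} → i ∣ a → j ∣ b → i ℤ.* j ∣ a ℤ.* b
*-pres-∣ {i} {b = b} i∣a j∣b = ℤ∣.∣-trans (ℤ∣.*-monoʳ-∣ i j∣b) (ℤ∣.*-monoˡ-∣ b i∣a)

∣ℕ⇒square-∣ : ∀ {d k} → d ∣ℕ k → + d ℤ.* + d ∣ + (k ℕ.* k)
∣ℕ⇒square-∣ {d} {k} d∣k = subst (+ d ℤ.* + d ∣_) (sym (ℤP.pos-* k k)) (*-pres-∣ d∣ᵤk d∣ᵤk)
  where
  d∣ᵤk : + d ∣ + k
  d∣ᵤk = ℤ∣.∣ᵤ⇒∣ d∣k

module PrimeDivisibility {p : ℕ} (p-prime : Prime p) where
  private
    instance
      p≢0 : ℕ.NonZero p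
      p≢0 = prime⇒nonZero p-prime
    P : ℤ
    P = + p
    open CommutativeSemigroupProperties ℤP.*-commutativeSemigroup using (interchange)

  ∣m*n⇒∣m⊎∣n : ∀ {a b} → P ∣ a ℤ.* b → P ∣ a ⊎ P ∣ b
  ∣m*n⇒∣m⊎∣n {a} {b} P∣ab = Sum.map ℤ∣.∣ᵤ⇒∣ ℤ∣.∣ᵤ⇒∣
    (euclidsLemma ℤ.∣ a ∣ ℤ.∣ b ∣ p-prime (subst (p ∣ℕ_) (ℤP.abs-* a b) (ℤ∣.∣⇒∣ᵤ P∣ab)))

  ∣m*m⇒∣m : ∀ {a} → P ∣ a ℤ.* a → P ∣ a
  ∣m*m⇒∣m = Sum.reduce ∘ ∣m*n⇒∣m⊎∣n

  ∣m*m+n*n∣n⇒∣m : ∀ {a b} → P ∣ a ℤ.* a ℤ.+ b ℤ.* b → P ∣ b → P ∣ a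
  ∣m*m+n*n∣n⇒∣m {b = b} P∣a²+b² P∣b = ∣m*m⇒∣m (ℤ∣.∣m+n∣n⇒∣m P∣a²+b² (ℤ∣.∣n⇒∣m*n b P∣b))

  P∣P*P : P ∣ P ℤ.* P
  P∣P*P = ℤ∣.∣m⇒∣m*n P ℤ∣.∣-refl

  ∤m∧P²∣m*n⇒P²∣n : ∀ {c n} → ¬ P ∣ c → P ℤ.* P ∣ c ℤ.* n → P ℤ.* P ∣ n
  ∤m∧P²∣m*n⇒P²∣n {c} P∤c P²∣cn with ∣m*n⇒∣m⊎∣n (ℤ∣.∣-trans P∣P*P P²∣cn)
  ... | inj₁ P∣c = contradiction P∣c P∤c
  ... | inj₂ (divides n′ refl) = ℤ∣.*-monoˡ-∣ P (Sum.fromInj₂ (λ P∣c → contradiction P∣c P∤c) (∣m*n⇒∣m⊎∣n P∣cn′))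
    where
    P∣cn′ : P ∣ c ℤ.* n′
    P∣cn′ = ℤ∣.*-cancelʳ-∣ P (subst (P ℤ.* P ∣_) (sym (ℤP.*-assoc c n′ P)) P²∣cn)

  P⁴∣m*m⇒P²∣m : ∀ {t} → (P ℤ.* P) ℤ.* (P ℤ.* P) ∣ t ℤ.* t → P ℤ.* P ∣ t
  P⁴∣m*m⇒P²∣m {t} P⁴∣t² with ∣m*m⇒∣m {t} (ℤ∣.∣-trans (ℤ∣.∣m⇒∣m*n (P ℤ.* P) P∣P*P) P⁴∣t²)
  ... | divides t′ refl = ℤ∣.*-monoˡ-∣ P (∣m*m⇒∣m {t′} (ℤ∣.∣-trans P∣P*P P²∣t′²))
    where
    instance _ = ℤP.i*j≢0 P P
    P²∣t′² : P ℤ.* P ∣ t′ ℤ.* t′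
    P²∣t′² = ℤ∣.*-cancelʳ-∣ (P ℤ.* P) (subst ((P ℤ.* P) ℤ.* (P ℤ.* P) ∣_) (interchange t′ P t′ P) P⁴∣t²)

4∣m*m+n*n⇒2∣n : ∀ x y → + 4 ∣ x ℤ.* x ℤ.+ y ℤ.* y → + 2 ∣ y
4∣m*m+n*n⇒2∣n x y 4∣x²+y² = ∣m*m⇒∣m (ℤ∣.*-cancelˡ-∣ (+ 2) 4∣2y²)
  where
  open Data.Integer.Base using (_+_; _*_; _-_; -_)
  open PrimeDivisibility prime[2]
  [x-y]² : (x * x + y * y) - + 2 * (x * y) ≡ (x - y) * (x - y)
  [x-y]² = ℤSolver.solve (x ∷ y ∷ [])
  2y² : ((x * x + y * y) - (x - y) * (x - y)) - + 2 * (x - y) * y ≡ + 2 * (y * y)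
  2y² = ℤSolver.solve (x ∷ y ∷ [])
  2∣x-y : + 2 ∣ x ℤ.- y
  2∣x-y = ∣m*m⇒∣m (subst (+ 2 ∣_) [x-y]²
    (ℤ∣.∣m∣n⇒∣m-n (ℤ∣.∣-trans (divides (+ 2) refl) 4∣x²+y²) (ℤ∣.∣m⇒∣m*n (x ℤ.* y) ℤ∣.∣-refl)))
  4∣2y² : + 2 ℤ.* + 2 ∣ + 2 ℤ.* (y ℤ.* y)
  4∣2y² = subst (+ 4 ∣_) 2y² (ℤ∣.∣m∣n⇒∣m-n (ℤ∣.∣m∣n⇒∣m-n 4∣x²+y² (*-pres-∣ 2∣x-y 2∣x-y))
                                          (ℤ∣.∣m⇒∣m*n y (ℤ∣.*-monoʳ-∣ (+ 2) 2∣x-y)))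

-- Thue's lemma and the aligning rotation

module _ {p : ℕ} (p-prime : Prime p) where
  open PrimeDivisibility p-prime
  private
    instance
      p≢0 : ℕ.NonZero p
      p≢0 = prime⇒nonZero p-prime
    P : ℤ
    P = + p

  short-solution-norm≡p : ∀ {x y a b m} → ¬ P ∣ y → P ∣ x ℤ.* x ℤ.+ y ℤ.* y → P ∣ a ℤ.* y ℤ.- b ℤ.* x →
                      ¬ (a ≡ + 0 × b ≡ + 0) → ℤ.∣ a ∣ ℕ.≤ m → ℤ.∣ b ∣ ℕ.≤ m → m ℕ.* m ℕ.≤ p →
                      a ℤ.* a ℤ.+ b ℤ.* b ≡ P
  short-solution-norm≡p {x} {y} {a} {b} {m} P∤y P∣x²+y² P∣ay-bx ab≢0 ∣a∣≤m ∣b∣≤m m²≤p =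
    trans a²+b²≡s (cong +_ (multiple-below-double (ℤ∣.∣⇒∣ᵤ (subst (P ∣_) a²+b²≡s P∣a²+b²)) s≢0 s<2p))
    where
    open Data.Integer.Base using (_+_; _*_; _-_; -_)
    lagrange : (a * y - b * x) * (a * y + b * x) + b * b * (x * x + y * y)
             ≡ y * y * (a * a + b * b)
    lagrange = ℤSolver.solve (a ∷ b ∷ x ∷ y ∷ [])
    P∣a²+b² : P ∣ a ℤ.* a ℤ.+ b ℤ.* b
    P∣a²+b² = Sum.fromInj₂ (λ P∣y² → contradiction (∣m*m⇒∣m P∣y²) P∤y) (∣m*n⇒∣m⊎∣n (subst (P ∣_) lagrange
      (ℤ∣.∣m∣n⇒∣m+n (ℤ∣.∣m⇒∣m*n (a ℤ.* y ℤ.+ b ℤ.* x) P∣ay-bx) (ℤ∣.∣n⇒∣m*n (b ℤ.* b) P∣x²+y²))))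
    s : ℕ
    s = ℤ.∣ a ∣ ℕ.* ℤ.∣ a ∣ ℕ.+ ℤ.∣ b ∣ ℕ.* ℤ.∣ b ∣
    a²+b²≡s : a ℤ.* a ℤ.+ b ℤ.* b ≡ + s
    a²+b²≡s = trans (cong₂ ℤ._+_ (square≡∣∣² a) (square≡∣∣² b)) (sym (ℤP.pos-+ (ℤ.∣ a ∣ ℕ.* ℤ.∣ a ∣) _))
    ∣∣²≡0⇒≡0 : ∀ c → ℤ.∣ c ∣ ℕ.* ℤ.∣ c ∣ ≡ 0 → c ≡ + 0
    ∣∣²≡0⇒≡0 c eq = ℤP.∣i∣≡0⇒i≡0 (Sum.reduce (ℕ.m*n≡0⇒m≡0∨n≡0 ℤ.∣ c ∣ eq))
    s≢0 : s ≢ 0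
    s≢0 s≡0 = ab≢0 (∣∣²≡0⇒≡0 a (ℕ.m+n≡0⇒m≡0 _ s≡0) , ∣∣²≡0⇒≡0 b (ℕ.m+n≡0⇒n≡0 (ℤ.∣ a ∣ ℕ.* ℤ.∣ a ∣) s≡0))
    m²<p : m ℕ.* m ℕ.< p
    m²<p = ℕ.≤∧≢⇒< m²≤p (prime≢square m p-prime ∘ sym)
    s<2p : s ℕ.< p ℕ.+ p
    s<2p = ℕ.+-mono-< (ℕ.≤-<-trans (ℕ.*-mono-≤ ∣a∣≤m ∣a∣≤m) m²<p) (ℕ.≤-<-trans (ℕ.*-mono-≤ ∣b∣≤m ∣b∣≤m) m²<p)

  thue : ∀ z → ¬ P ∣ proj₂ z → P ∣ ℤ².norm z →
         Σ ℤ² λ π → ℤ².norm π ≡ P × P ∣ proj₂ (ℤ².conj π ℤ².* z)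
  thue (x , y) P∤y P∣x²+y² =
    let m , m²≤p , p<[1+m]² = floor-sqrt p
        a , b , ab≢0 , ∣a∣≤m , ∣b∣≤m , P∣ay-bx = box-pigeonhole p m x y p<[1+m]²
    in  (a , b) , short-solution-norm≡p P∤y P∣x²+y² P∣ay-bx ab≢0 ∣a∣≤m ∣b∣≤m m²≤p , subst (P ∣_) (cross≡ a b) P∣ay-bx
    where
    open Data.Integer.Base using (_+_; _*_; _-_; -_)
    cross≡ : ∀ a b → a * y - b * x ≡ - b * x + a * y
    cross≡ a b = ℤSolver.solve (a ∷ b ∷ x ∷ y ∷ [])

  P∤2 : ∀ z → ¬ P ∣ proj₂ z → P ℤ.* P ∣ ℤ².norm z → ¬ P ∣ + 2
  P∤2 (x , y) P∤y P²∣x²+y² P∣2 with irreducible[2] (ℤ∣.∣⇒∣ᵤ P∣2)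
  ... | inj₁ refl = ¬prime[1] p-prime
  ... | inj₂ refl = P∤y (4∣m*m+n*n⇒2∣n x y P²∣x²+y²)

  module _ (π : ℤ²) (Nπ≡P : ℤ².norm π ≡ P) where
    private
      π̄ : ℤ²
      π̄ = ℤ².conj π
      N[π̄z]≡P*Nz : ∀ z → ℤ².norm (π̄ ℤ².* z) ≡ P ℤ.* ℤ².norm z
      N[π̄z]≡P*Nz z = trans (norm-* π̄ z) (cong (ℤ._* ℤ².norm z) (trans (norm-conj π) Nπ≡P))
      P∣²π̄z : ∀ z → P ∣ proj₂ (π̄ ℤ².* z) → P ∣² π̄ ℤ².* z
      P∣²π̄z z P∣v = ∣m*m+n*n∣n⇒∣m (subst (P ∣_) (sym (N[π̄z]≡P*Nz z)) (ℤ∣.∣m⇒∣m*n (ℤ².norm z) ℤ∣.∣-refl)) P∣v , P∣v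

    π-divides : ∀ z → P ∣ proj₂ (π̄ ℤ².* z) → Σ ℤ² λ w → z ≡ π ℤ².* w
    π-divides z P∣v = w , ·-cancelˡ P (begin
      P ℤ².· z                   ≡⟨ cong (ℤ²._· z) Nπ≡P ⟨
      ℤ².norm π ℤ².· z           ≡⟨ *-conj-*≡norm-· π z ⟨
      π ℤ².* (π̄ ℤ².* z)           ≡⟨ cong (π ℤ².*_) π̄z≡Pw ⟩
      π ℤ².* (P ℤ².· w)           ≡⟨ *-·-comm π P w ⟩
      P ℤ².· (π ℤ².* w)           ∎)
      where
      open ≡-Reasoning
      w : ℤ²
      w = proj₁ (∣²⇒≡· (π̄ ℤ².* z) (P∣²π̄z z P∣v))
      π̄z≡Pw : π̄ ℤ².* z ≡ P ℤ².· w
      π̄z≡Pw = proj₂ (∣²⇒≡· (π̄ ℤ².* z) (P∣²π̄z z P∣v))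

    π̄²-clears : ∀ w → ¬ P ∣ proj₂ (π ℤ².* w) → P ℤ.* P ∣ ℤ².norm (π ℤ².* w) →
                P ℤ.* P ∣² (π̄ ℤ².* π̄) ℤ².* (π ℤ².* w)
    π̄²-clears w P∤y P²∣N[πw] = subst (P ℤ.* P ∣²_) (sym (trans (conj²-*≡norm-·-conj π w) (cong (ℤ²._· (π̄ ℤ².* w)) Nπ≡P)))
      (∣²⇒*∣²· (π̄ ℤ².* w) (P∣²π̄z w P∣v))
      where
      P∣Nw : P ∣ ℤ².norm w
      P∣Nw = ℤ∣.*-cancelˡ-∣ P (subst (P ℤ.* P ∣_) (trans (norm-* π w) (cong (ℤ._* ℤ².norm w) Nπ≡P)) P²∣N[πw])
      P∣Im[π̄w]Im[πw] : P ∣ proj₂ (π̄ ℤ².* w) ℤ.* proj₂ (π ℤ².* w)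
      P∣Im[π̄w]Im[πw] = subst (P ∣_) (sym (product-of-imaginary-parts π w))
        (ℤ∣.∣m∣n⇒∣m-n (ℤ∣.∣n⇒∣m*n (proj₁ π ℤ.* proj₁ π) P∣Nw) (ℤ∣.∣m⇒∣m*n (proj₁ w ℤ.* proj₁ w) (ℤ∣.∣-reflexive (sym Nπ≡P))))
      P∣v : P ∣ proj₂ (π̄ ℤ².* w)
      P∣v = Sum.fromInj₁ (λ P∣y → contradiction P∣y P∤y) (∣m*n⇒∣m⊎∣n P∣Im[π̄w]Im[πw])

  rotation-clears : ∀ π → ℤ².norm π ≡ P → ∀ z → P ∣ proj₂ (ℤ².conj π ℤ².* z) → ¬ P ∣ proj₂ z → P ℤ.* P ∣ ℤ².norm z →
                    P ℤ.* P ∣² (ℤ².conj π ℤ².* ℤ².conj π) ℤ².* z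
  rotation-clears π Nπ≡P z P∣v P∤y P²∣Nz =
    let w , z≡πw = π-divides π Nπ≡P z P∣v
    in  subst (λ z → P ℤ.* P ∣² (ℤ².conj π ℤ².* ℤ².conj π) ℤ².* z) (sym z≡πw)
          (π̄²-clears π Nπ≡P w (subst (λ z → ¬ P ∣ proj₂ z) z≡πw P∤y) (subst (λ z → P ℤ.* P ∣ ℤ².norm z) z≡πw P²∣Nz))

  P²∣Im[z̄₀z] : ∀ z₀ z → ¬ P ∣ + 2 → P ℤ.* P ∣ ℤ².norm z₀ → P ℤ.* P ∣ ℤ².norm z → P ℤ.* P ∣ ℤ².norm (z ℤ².- z₀) →
               P ℤ.* P ∣ proj₂ (ℤ².conj z₀ ℤ².* z)
  P²∣Im[z̄₀z] z₀@(x₀ , y₀) z@(x , y) P∤2 P²∣Nz₀ P²∣Nz P²∣N[z-z₀] =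
    P⁴∣m*m⇒P²∣m (ℤ∣.∣m+n∣m⇒∣n P⁴∣Re²+Im² (*-pres-∣ P²∣Re P²∣Re))
    where
    open Data.Integer.Base using (_+_; _*_; _-_; -_)
    polarization : + 2 * (x₀ * x - - y₀ * y)
                 ≡ (x * x + y * y) + (x₀ * x₀ + y₀ * y₀) - ((x - x₀) * (x - x₀) + (y - y₀) * (y - y₀))
    polarization = ℤSolver.solve (x₀ ∷ y₀ ∷ x ∷ y ∷ [])
    P²∣Re : P ℤ.* P ∣ proj₁ (ℤ².conj z₀ ℤ².* z)
    P²∣Re = ∤m∧P²∣m*n⇒P²∣n P∤2
      (subst (P ℤ.* P ∣_) (sym polarization) (ℤ∣.∣m∣n⇒∣m-n (ℤ∣.∣m∣n⇒∣m+n P²∣Nz P²∣Nz₀) P²∣N[z-z₀]))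
    P⁴∣Re²+Im² : (P ℤ.* P) ℤ.* (P ℤ.* P) ∣ ℤ².norm (ℤ².conj z₀ ℤ².* z)
    P⁴∣Re²+Im² = subst ((P ℤ.* P) ℤ.* (P ℤ.* P) ∣_) (sym (trans (norm-* (ℤ².conj z₀) z) (cong (ℤ._* ℤ².norm z) (norm-conj z₀))))
      (*-pres-∣ P²∣Nz₀ P²∣Nz)

  clears-parallel : ∀ ω z₀ z → ¬ P ∣ proj₂ z₀ → P ℤ.* P ∣² ω ℤ².* z₀ → P ℤ.* P ∣ proj₂ (ℤ².conj z₀ ℤ².* z) →
                    P ℤ.* P ∣² ω ℤ².* z
  clears-parallel ω@(A , B) z₀@(x₀ , y₀) z@(x , y) P∤y₀ P²∣²ωz₀ P²∣Im =
    ∤m∧P²∣m*n⇒P²∣n P∤y₀ (proj₁ P²∣²y₀ωz) , ∤m∧P²∣m*n⇒P²∣n P∤y₀ (proj₂ P²∣²y₀ωz)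
    where
    parallel : y ℤ².· (ω ℤ².* z₀) ℤ².- proj₂ (ℤ².conj z₀ ℤ².* z) ℤ².· ω ≡ y₀ ℤ².· (ω ℤ².* z)
    parallel = cong₂ _,_ (identity₁ A B x₀ y₀ x y) (identity₂ A B x₀ y₀ x y)
      where
      open Data.Integer.Base using (_+_; _*_; _-_; -_)
      identity₁ : ∀ A B x₀ y₀ x y → y * (A * x₀ - B * y₀) - (- y₀ * x + x₀ * y) * A ≡ y₀ * (A * x - B * y)
      identity₁ = ℤSolver.solve-∀
      identity₂ : ∀ A B x₀ y₀ x y → y * (B * x₀ + A * y₀) - (- y₀ * x + x₀ * y) * B ≡ y₀ * (B * x + A * y)
      identity₂ = ℤSolver.solve-∀
    P²∣²y₀ωz : P ℤ.* P ∣² y₀ ℤ².· (ω ℤ².* z)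
    P²∣²y₀ωz = subst (P ℤ.* P ∣²_) parallel (∣²-∣²⇒∣²- _ _ (∣²⇒∣²· y (ω ℤ².* z₀) P²∣²ωz₀) (∣⇒∣²· ω P²∣Im))

  aligning-rotation : ∀ z₀ → ¬ P ∣ proj₂ z₀ → P ℤ.* P ∣ ℤ².norm z₀ →
                      Σ ℤ² λ ω → ℤ².norm ω ≡ P ℤ.* P ×
                        (∀ z → P ℤ.* P ∣ ℤ².norm z → P ℤ.* P ∣ ℤ².norm (z ℤ².- z₀) → P ℤ.* P ∣² ω ℤ².* z)
  aligning-rotation z₀ P∤y₀ P²∣Nz₀ =
    let π , Nπ≡P , P∣Im[π̄z₀] = thue z₀ P∤y₀ (ℤ∣.∣-trans P∣P*P P²∣Nz₀)
        π̄ = ℤ².conj π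
        Nπ̄≡P = trans (norm-conj π) Nπ≡P
    in  π̄ ℤ².* π̄ , trans (norm-* π̄ π̄) (cong₂ ℤ._*_ Nπ̄≡P Nπ̄≡P) , λ z P²∣Nz P²∣N[z-z₀] →
          clears-parallel (π̄ ℤ².* π̄) z₀ z P∤y₀ (rotation-clears π Nπ≡P z₀ P∣Im[π̄z₀] P∤y₀ P²∣Nz₀)
            (P²∣Im[z̄₀z] z₀ z (P∤2 z₀ P∤y₀ P²∣Nz₀) P²∣Nz₀ P²∣Nz P²∣N[z-z₀])

-- Moving integer point sets into (dℤ)²

-- In-pℤ² d x unfolds to x ≡ ι² (+ d ℤ².· (a , b)) for some a and b.
MovableInto : ℕ → (ℤ² → Set) → Set
MovableInto d M = Σ (ℚ² → ℚ²) λ T → IsMotion T × (∀ x → M x → In-pℤ² d (T (ι² x)))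

DistancesDivisibleBy : ℕ → (ℤ² → Set) → Set
DistancesDivisibleBy d M = ∀ x y → M x → M y → Σ ℕ λ k → (d ∣ℕ k) × DistIs (ι² x) (ι² y) k

Alignable : ℕ → Set₁
Alignable d = (M : ℤ² → Set) → DistancesDivisibleBy d M → ¬ ¬ MovableInto d M

translation-aligns : ∀ p {M : ℤ² → Set} m₀ → (∀ x → M x → + p ∣² x ℤ².- m₀) → MovableInto p M
translation-aligns p m₀ aligned = (ℚ²._- ι² m₀) , translate-isMotion (ι² m₀) , λ x x∈M →
  let (a , b) , x-m₀≡pw = ∣²⇒≡· (x ℤ².- m₀) (aligned x x∈M)
  in  a , b , trans (sym (ι²-- x m₀)) (cong ι² x-m₀≡pw)

rotation-aligns : ∀ p .{{_ : ℕ.NonZero p}} {M : ℤ² → Set} ω m₀ → ℤ².norm ω ≡ + p ℤ.* + p →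
                  (∀ x → M x → + p ℤ.* + p ∣² ω ℤ².* (x ℤ².- m₀)) → MovableInto p M
rotation-aligns p ω m₀ Nω≡p² aligned = T , T-isMotion , λ x x∈M →
  let w , ω[x-m₀]≡p²w = ∣²⇒≡· (ω ℤ².* (x ℤ².- m₀)) (aligned x x∈M)
  in  proj₁ w , proj₂ w , (begin
    T (ι² x)                                          ≡⟨ cong (λ z → (+ 1 ℚ./ p) ℚ².· (ι² ω ℚ².* z)) (ι²-- x m₀) ⟨
    (+ 1 ℚ./ p) ℚ².· (ι² ω ℚ².* ι² (x ℤ².- m₀))       ≡⟨ cong ((+ 1 ℚ./ p) ℚ².·_) (ι²-* ω (x ℤ².- m₀)) ⟨
    (+ 1 ℚ./ p) ℚ².· ι² (ω ℤ².* (x ℤ².- m₀))          ≡⟨ cong (λ z → (+ 1 ℚ./ p) ℚ².· ι² z) (trans ω[x-m₀]≡p²w (sym (·-assoc (+ p) (+ p) w))) ⟩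
    (+ 1 ℚ./ p) ℚ².· ι² (+ p ℤ².· (+ p ℤ².· w))       ≡⟨ ι²-unscale p (+ p ℤ².· w) ⟩
    ι² (+ p ℤ².· w)                                   ∎)
  where
  open ≡-Reasoning
  T : ℚ² → ℚ²
  T z = (+ 1 ℚ./ p) ℚ².· (ι² ω ℚ².* (z ℚ².- ι² m₀))
  T-isMotion : IsMotion T
  T-isMotion x y = trans (rotation-isMotion p ω Nω≡p² (x ℚ².- ι² m₀) (y ℚ².- ι² m₀)) (translate-isMotion (ι² m₀) x y)

alignable-prime : ∀ {p} → Prime p → Alignable p
alignable-prime {p} p-prime M dist = ¬¬-excluded-middle >>= λ where
    (no M≡∅) → pure ((λ z → z) , (λ _ _ → refl) , λ x x∈M → contradiction (x , x∈M) M≡∅)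
    (yes (m₀ , m₀∈M)) → ¬¬-excluded-middle >>= λ where
      (no M⊆m₀+pℤ²) → pure (translation-aligns p {M} m₀ λ x x∈M → aligned {m₀} {x} m₀∈M x∈M (decide {m₀} M⊆m₀+pℤ² {x} x∈M))
      (yes (w , w∈M , P∤y)) →
        let ω , Nω≡P² , clears = aligning-rotation p-prime (w ℤ².- m₀) P∤y (P²∣N w∈M m₀∈M)
        in  pure (rotation-aligns p {M} ω m₀ Nω≡P² λ x x∈M →
                   clears (x ℤ².- m₀) (P²∣N x∈M m₀∈M) (subst (P ℤ.* P ∣_) (shift x w m₀) (P²∣N x∈M w∈M)))
  where
  open RawMonad ¬¬-Monad
  open PrimeDivisibility p-prime
  instance _ = prime⇒nonZero p-prime
  P = + p
  P²∣N : ∀ {x y} → M x → M y → P ℤ.* P ∣ ℤ².norm (x ℤ².- y)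
  P²∣N {x} {y} x∈M y∈M = let k , p∣k , d = dist x y x∈M y∈M in subst (P ℤ.* P ∣_) (DistIs-ι²⇒norm {x} {y} {k} d) (∣ℕ⇒square-∣ p∣k)
  shift : ∀ x w m₀ → ℤ².norm (x ℤ².- w) ≡ ℤ².norm ((x ℤ².- m₀) ℤ².- (w ℤ².- m₀))
  shift (a , b) (c , d) (e , f) = cong₂ (λ u v → u ℤ.* u ℤ.+ v ℤ.* v) (sym (cancel a c e)) (sym (cancel b d f))
    where
    open Data.Integer.Base using (_+_; _*_; _-_; -_)
    cancel : ∀ a b c → (a - c) - (b - c) ≡ a - b
    cancel = ℤSolver.solve-∀
  decide : ∀ {m₀} → ¬ (Σ ℤ² λ w → M w × ¬ P ∣ proj₂ (w ℤ².- m₀)) → ∀ {x} → M x → P ∣ proj₂ (x ℤ².- m₀)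
  decide {m₀} none {x} x∈M with P ℤ∣.∣? proj₂ (x ℤ².- m₀)
  ... | yes P∣y = P∣y
  ... | no  P∤y = contradiction (x , x∈M , P∤y) none
  aligned : ∀ {m₀ x} → M m₀ → M x → P ∣ proj₂ (x ℤ².- m₀) → P ∣² x ℤ².- m₀
  aligned m₀∈M x∈M P∣y = ∣m*m+n*n∣n⇒∣m (ℤ∣.∣-trans P∣P*P (P²∣N x∈M m₀∈M)) P∣y , P∣y

alignable-1 : Alignable 1
alignable-1 M _ = pure ((λ z → z) , (λ _ _ → refl) , λ (a , b) _ →
  a , b , cong₂ _,_ (cong ιℤ (sym (ℤP.*-identityˡ a))) (cong ιℤ (sym (ℤP.*-identityˡ b))))
  where open RawMonad ¬¬-Monad

alignable-* : ∀ {m n} .{{_ : ℕ.NonZero m}} → Alignable m → Alignable n → Alignable (m ℕ.* n)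
alignable-* {m} {n} align-m align-n M dist = do
    T₁ , T₁-isMotion , T₁-aligns ← align-m M dist-m
    T₂ , T₂-isMotion , T₂-aligns ← align-n (M′ T₁) (dist-M′ T₁ T₁-isMotion)
    pure (T T₁ T₂ , T-isMotion T₁ T₂ T₁-isMotion T₂-isMotion , T-aligns T₁ T₂ T₁-aligns T₂-aligns)
  where
  open RawMonad ¬¬-Monad
  open ≡-Reasoning
  dist-m : ∀ x y → M x → M y → Σ ℕ λ k → m ∣ℕ k × DistIs (ι² x) (ι² y) k
  dist-m x y x∈M y∈M = let k , mn∣k , d = dist x y x∈M y∈M in k , ℕ∣.∣-trans (ℕ∣.m∣m*n n) mn∣k , d
  M′ : (ℚ² → ℚ²) → ℤ² → Set
  M′ T₁ z = Σ ℤ² λ x → M x × T₁ (ι² x) ≡ ι² (+ m ℤ².· z)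
  dist-M′ : ∀ T₁ → IsMotion T₁ → ∀ z w → M′ T₁ z → M′ T₁ w → Σ ℕ λ k → n ∣ℕ k × DistIs (ι² z) (ι² w) k
  dist-M′ T₁ T₁-isMotion z w (x , x∈M , T₁x≡mz) (y , y∈M , T₁y≡mw) =
    let k , ℕ∣.divides c k≡c[mn] , d = dist x y x∈M y∈M
    in  c ℕ.* n , ℕ∣.n∣m*n c , DistIs-unscale m z w (c ℕ.* n)
          (subst (DistIs (ι² (+ m ℤ².· z)) (ι² (+ m ℤ².· w))) (trans k≡c[mn] (regroup c))
            (subst₂ (λ u v → DistIs u v k) T₁x≡mz T₁y≡mw (DistIs-isMotion {T₁} {ι² x} {ι² y} {k} T₁-isMotion d)))
    where
    regroup : ∀ c → c ℕ.* (m ℕ.* n) ≡ m ℕ.* (c ℕ.* n)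
    regroup c = ℕ-solve (c ∷ m ∷ n ∷ [])
  T : (ℚ² → ℚ²) → (ℚ² → ℚ²) → ℚ² → ℚ²
  T T₁ T₂ z = ιℤ (+ m) ℚ².· T₂ ((+ 1 ℚ./ m) ℚ².· T₁ z)
  T-isMotion : ∀ T₁ T₂ → IsMotion T₁ → IsMotion T₂ → IsMotion (T T₁ T₂)
  T-isMotion T₁ T₂ T₁-isMotion T₂-isMotion x y =
    trans (conjugate-isMotion T₂ (ιℤ (+ m)) (+ 1 ℚ./ m) (/-inverseʳ m) T₂-isMotion (T₁ x) (T₁ y)) (T₁-isMotion x y)
  T-aligns : ∀ T₁ T₂ → (∀ x → M x → In-pℤ² m (T₁ (ι² x))) → (∀ z → M′ T₁ z → In-pℤ² n (T₂ (ι² z))) →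
             ∀ x → M x → In-pℤ² (m ℕ.* n) (T T₁ T₂ (ι² x))
  T-aligns T₁ T₂ T₁-aligns T₂-aligns x x∈M =
    let a , b , T₁x≡m[a,b] = T₁-aligns x x∈M
        c , d , T₂[a,b]≡n[c,d] = T₂-aligns (a , b) (x , x∈M , T₁x≡m[a,b])
    in  c , d , (begin
      ιℤ (+ m) ℚ².· T₂ ((+ 1 ℚ./ m) ℚ².· T₁ (ι² x))                ≡⟨ cong (λ z → ιℤ (+ m) ℚ².· T₂ ((+ 1 ℚ./ m) ℚ².· z)) T₁x≡m[a,b] ⟩
      ιℤ (+ m) ℚ².· T₂ ((+ 1 ℚ./ m) ℚ².· ι² (+ m ℤ².· (a , b)))   ≡⟨ cong (λ z → ιℤ (+ m) ℚ².· T₂ z) (ι²-unscale m (a , b)) ⟩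
      ιℤ (+ m) ℚ².· T₂ (ι² (a , b))                               ≡⟨ cong (ιℤ (+ m) ℚ².·_) T₂[a,b]≡n[c,d] ⟩
      ιℤ (+ m) ℚ².· ι² (+ n ℤ².· (c , d))                         ≡⟨ ι²-· (+ m) (+ n ℤ².· (c , d)) ⟨
      ι² (+ m ℤ².· (+ n ℤ².· (c , d)))                            ≡⟨ cong ι² (trans (·-assoc (+ m) (+ n) (c , d)) (cong (ℤ²._· (c , d)) (sym (ℤP.pos-* m n)))) ⟩
      ι² (+ (m ℕ.* n) ℤ².· (c , d))                               ∎)

alignable-product : ∀ {ps} → All Prime ps → Alignable (product ps)
alignable-product All.[]                   = alignable-1
alignable-product (p-prime All.∷ ps-prime) =
  alignable-* {{prime⇒nonZero p-prime}} (alignable-prime p-prime) (alignable-product ps-prime)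

alignable : ∀ d .{{_ : ℕ.NonZero d}} → Alignable d
alignable d = subst Alignable (sym isFactorisation) (alignable-product factorsPrime)
  where open PrimeFactorisation (factorise d)

-- Rational point sets with integral distances

denominators : ℚ² → ℕ
denominators (x , y) = ↧ₙ x ℕ.* ↧ₙ y

denominators-clear : ∀ u → ιℤ (+ denominators u) ℚ².· u ≡ ι² (↥ proj₁ u ℤ.* ↧ proj₂ u , ↥ proj₂ u ℤ.* ↧ proj₁ u)
denominators-clear (x , y) = cong₂ _,_ (clear x y) (trans (cong (ℚ._* y) (cong ιℤ (cong +_ (ℕ.*-comm (↧ₙ x) (↧ₙ y))))) (clear y x))
  where
  open ≡-Reasoning
  clear : ∀ x y → ιℤ (+ (↧ₙ x ℕ.* ↧ₙ y)) ℚ.* x ≡ ιℤ (↥ x ℤ.* ↧ y)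
  clear x y = begin
    ιℤ (+ (↧ₙ x ℕ.* ↧ₙ y)) ℚ.* x          ≡⟨ cong (ℚ._* x) (ιℤ-pos-* (↧ₙ x) (↧ₙ y)) ⟩
    (ιℤ (↧ x) ℚ.* ιℤ (↧ y)) ℚ.* x          ≡⟨ rearrange (ιℤ (↧ x)) (ιℤ (↧ y)) x ⟩
    (ιℤ (↧ x) ℚ.* x) ℚ.* ιℤ (↧ y)          ≡⟨ cong (ℚ._* ιℤ (↧ y)) (↧-clears x) ⟩
    ιℤ (↥ x) ℚ.* ιℤ (↧ y)                  ≡⟨ ιℤ-* (↥ x) (↧ y) ⟨
    ιℤ (↥ x ℤ.* ↧ y)                       ∎
    where
    open Data.Rational.Base using (_+_; _*_; _-_; -_)
    rearrange : ∀ a b c → (a * b) * c ≡ (a * c) * b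
    rearrange = RingSolver.solve-∀ ringℚ

twice-conj-*-integral : ∀ u v k₁ k₂ k₃ →
                        ιℤ (+ k₁) ≡ ℚ².norm u → ιℤ (+ k₂) ≡ ℚ².norm v → ιℤ (+ k₃) ≡ ℚ².norm (u ℚ².- v) →
                        Σ ℤ² λ N → ι² N ≡ ιℤ (+ 2) ℚ².· (ℚ².conj u ℚ².* v)
twice-conj-*-integral u@(u₁ , u₂) v@(v₁ , v₂) k₁ k₂ k₃ ∣u∣² ∣v∣² ∣u-v∣² =
  (N₁ , ↥ Q) , cong₂ _,_ ιN₁≡P (sym (square-integral⇒integral Q N₂² ιN₂²≡Q²))
  where
  open Data.Rational.Base using (_+_; _*_; _-_; -_)
  open ≡-Reasoning
  two P Q : ℚ
  two = ιℤ (+ 2)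
  P = proj₁ (two ℚ².· (ℚ².conj u ℚ².* v))
  Q = proj₂ (two ℚ².· (ℚ².conj u ℚ².* v))
  polarization : (u₁ * u₁ + u₂ * u₂) + (v₁ * v₁ + v₂ * v₂) - ((u₁ - v₁) * (u₁ - v₁) + (u₂ - v₂) * (u₂ - v₂))
               ≡ two * (u₁ * v₁ - - u₂ * v₂)
  polarization = RingSolver.solve (u₁ ∷ u₂ ∷ v₁ ∷ v₂ ∷ []) ringℚ
  lagrange : ιℤ (+ 4) * ((u₁ * u₁ + u₂ * u₂) * (v₁ * v₁ + v₂ * v₂))
               - (two * (u₁ * v₁ - - u₂ * v₂)) * (two * (u₁ * v₁ - - u₂ * v₂))
           ≡ (two * (- u₂ * v₁ + u₁ * v₂)) * (two * (- u₂ * v₁ + u₁ * v₂))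
  lagrange = RingSolver.solve (u₁ ∷ u₂ ∷ v₁ ∷ v₂ ∷ []) ringℚ
  N₁ N₂² : ℤ
  N₁ = + k₁ ℤ.+ + k₂ ℤ.- + k₃
  N₂² = + 4 ℤ.* (+ k₁ ℤ.* + k₂) ℤ.- N₁ ℤ.* N₁
  ιN₁≡P : ιℤ N₁ ≡ P
  ιN₁≡P = begin
    ιℤ (+ k₁ ℤ.+ + k₂ ℤ.- + k₃)                    ≡⟨ trans (ιℤ-- (+ k₁ ℤ.+ + k₂) (+ k₃)) (cong (ℚ._- ιℤ (+ k₃)) (ιℤ-+ (+ k₁) (+ k₂))) ⟩
    ιℤ (+ k₁) ℚ.+ ιℤ (+ k₂) ℚ.- ιℤ (+ k₃)           ≡⟨ cong₂ ℚ._-_ (cong₂ ℚ._+_ ∣u∣² ∣v∣²) ∣u-v∣² ⟩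
    ℚ².norm u ℚ.+ ℚ².norm v ℚ.- ℚ².norm (u ℚ².- v)  ≡⟨ polarization ⟩
    P                                              ∎
  ιN₂²≡Q² : Q ℚ.* Q ≡ ιℤ N₂²
  ιN₂²≡Q² = begin
    Q ℚ.* Q                                                      ≡⟨ lagrange ⟨
    ιℤ (+ 4) ℚ.* (ℚ².norm u ℚ.* ℚ².norm v) ℚ.- P ℚ.* P            ≡⟨ cong₂ (λ a b → ιℤ (+ 4) ℚ.* a ℚ.- b ℚ.* b) ∣u∣²∣v∣² ιN₁≡P ⟨
    ιℤ (+ 4) ℚ.* (ιℤ (+ k₁) ℚ.* ιℤ (+ k₂)) ℚ.- ιℤ N₁ ℚ.* ιℤ N₁    ≡⟨ cong₂ ℚ._-_ ι[4k₁k₂] (ιℤ-* N₁ N₁) ⟨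
    ιℤ (+ 4 ℤ.* (+ k₁ ℤ.* + k₂)) ℚ.- ιℤ (N₁ ℤ.* N₁)               ≡⟨ ιℤ-- (+ 4 ℤ.* (+ k₁ ℤ.* + k₂)) (N₁ ℤ.* N₁) ⟨
    ιℤ N₂²                                                       ∎
    where
    ∣u∣²∣v∣² : ιℤ (+ k₁) ℚ.* ιℤ (+ k₂) ≡ ℚ².norm u ℚ.* ℚ².norm v
    ∣u∣²∣v∣² = cong₂ ℚ._*_ ∣u∣² ∣v∣²
    ι[4k₁k₂] : ιℤ (+ 4 ℤ.* (+ k₁ ℤ.* + k₂)) ≡ ιℤ (+ 4) ℚ.* (ιℤ (+ k₁) ℚ.* ιℤ (+ k₂))
    ι[4k₁k₂] = trans (ιℤ-* (+ 4) (+ k₁ ℤ.* + k₂)) (cong (ιℤ (+ 4) ℚ.*_) (ιℤ-* (+ k₁) (+ k₂)))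

scaled-integral : ∀ u v k₁ k₂ k₃ →
                  ιℤ (+ k₁) ≡ ℚ².norm u → ιℤ (+ k₂) ≡ ℚ².norm v → ιℤ (+ k₃) ≡ ℚ².norm (u ℚ².- v) →
                  Σ ℤ² λ z → ι² z ≡ ιℤ (+ (2 ℕ.* k₁ ℕ.* denominators u)) ℚ².· v
scaled-integral u v k₁ k₂ k₃ ∣u∣² ∣v∣² ∣u-v∣² =
  let N , ιN≡2ū*v = twice-conj-*-integral u v k₁ k₂ k₃ ∣u∣² ∣v∣² ∣u-v∣²
      U = (↥ proj₁ u ℤ.* ↧ proj₂ u , ↥ proj₂ u ℤ.* ↧ proj₁ u)
  in  U ℤ².* N , (begin
    ι² (U ℤ².* N)                                                            ≡⟨ ι²-* U N ⟩
    ι² U ℚ².* ι² N                                                           ≡⟨ cong₂ ℚ²._*_ (denominators-clear u) (sym ιN≡2ū*v) ⟨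
    (ιℤ (+ d) ℚ².· u) ℚ².* (ιℤ (+ 2) ℚ².· (ℚ².conj u ℚ².* v))                ≡⟨ u-*-conj-u (ιℤ (+ d)) (ιℤ (+ 2)) u v ⟩
    ((ιℤ (+ 2) ℚ.* ℚ².norm u) ℚ.* ιℤ (+ d)) ℚ².· v                            ≡⟨ cong (λ n → ((ιℤ (+ 2) ℚ.* n) ℚ.* ιℤ (+ d)) ℚ².· v) ∣u∣² ⟨
    ((ιℤ (+ 2) ℚ.* ιℤ (+ k₁)) ℚ.* ιℤ (+ d)) ℚ².· v                            ≡⟨ cong (ℚ²._· v) (trans (ιℤ-pos-* (2 ℕ.* k₁) d) (cong (ℚ._* ιℤ (+ d)) (ιℤ-pos-* 2 k₁))) ⟨
    ιℤ (+ (2 ℕ.* k₁ ℕ.* d)) ℚ².· v                                           ∎)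
  where
  open ≡-Reasoning
  d = denominators u
  u-*-conj-u : ∀ s t u v → (s ℚ².· u) ℚ².* (t ℚ².· (ℚ².conj u ℚ².* v)) ≡ ((t ℚ.* ℚ².norm u) ℚ.* s) ℚ².· v
  u-*-conj-u s t (u₁ , u₂) (v₁ , v₂) = cong₂ _,_ (identity₁ s t u₁ u₂ v₁ v₂) (identity₂ s t u₁ u₂ v₁ v₂)
    where
    open Data.Rational.Base using (_+_; _*_; _-_; -_)
    identity₁ : ∀ s t u₁ u₂ v₁ v₂ → (s * u₁) * (t * (u₁ * v₁ - - u₂ * v₂)) - (s * u₂) * (t * (- u₂ * v₁ + u₁ * v₂))
                                  ≡ ((t * (u₁ * u₁ + u₂ * u₂)) * s) * v₁
    identity₁ = RingSolver.solve-∀ ringℚ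
    identity₂ : ∀ s t u₁ u₂ v₁ v₂ → (s * u₂) * (t * (u₁ * v₁ - - u₂ * v₂)) + (s * u₁) * (t * (- u₂ * v₁ + u₁ * v₂))
                                  ≡ ((t * (u₁ * u₁ + u₂ * u₂)) * s) * v₂
    identity₂ = RingSolver.solve-∀ ringℚ

IntegralDistances : (ℚ² → Set) → Set
IntegralDistances M = ∀ x y → M x → M y → Σ ℕ (DistIs x y)

MovableIntoℤ² : (ℚ² → Set) → Set
MovableIntoℤ² M = Σ (ℚ² → ℚ²) λ T → IsMotion T × (∀ x → M x → Inℤ² (T x))

movable-given-separated-pair : ∀ M → IntegralDistances M → ∀ {m₀ m₁ K} → M m₀ → M m₁ → DistIs m₁ m₀ (suc K) →
                               ¬ ¬ MovableIntoℤ² M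
movable-given-separated-pair M dist {m₀} {m₁} {K} m₀∈M m₁∈M ∣m₁-m₀∣ = do
    T′ , T′-isMotion , T′-aligns ← alignable D W W-dist
    pure (T T′ , T-isMotion T′ T′-isMotion , T-integral T′ T′-aligns)
  where
  open RawMonad ¬¬-Monad
  open ≡-Reasoning
  u = m₁ ℚ².- m₀
  D = 2 ℕ.* (suc K ℕ.* suc K) ℕ.* denominators u
  W : ℤ² → Set
  W z = Σ ℚ² λ m → M m × ι² z ≡ ιℤ (+ D) ℚ².· (m ℚ².- m₀)
  W-dist : ∀ z w → W z → W w → Σ ℕ λ k → D ∣ℕ k × DistIs (ι² z) (ι² w) k
  W-dist z w (m , m∈M , ιz≡Dm) (m′ , m′∈M , ιw≡Dm′) =
    let k , ∣m-m′∣ = dist m m′ m∈M m′∈M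
    in  D ℕ.* k , ℕ∣.m∣m*n k ,
        subst₂ (λ a b → DistIs a b (D ℕ.* k)) (sym ιz≡Dm) (sym ιw≡Dm′)
          (DistIs-scale D {m ℚ².- m₀} {m′ ℚ².- m₀} {k} (DistIs-isMotion {ℚ²._- m₀} {m} {m′} {k} (translate-isMotion m₀) ∣m-m′∣))
  T : (ℚ² → ℚ²) → ℚ² → ℚ²
  T T′ z = (+ 1 ℚ./ D) ℚ².· T′ (ιℤ (+ D) ℚ².· (z ℚ².- m₀))
  T-isMotion : ∀ T′ → IsMotion T′ → IsMotion (T T′)
  T-isMotion T′ T′-isMotion x y =
    trans (conjugate-isMotion T′ (+ 1 ℚ./ D) (ιℤ (+ D)) (/-inverseˡ D) T′-isMotion (x ℚ².- m₀) (y ℚ².- m₀)) (translate-isMotion m₀ x y)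
  T-integral : ∀ T′ → (∀ z → W z → In-pℤ² D (T′ (ι² z))) → ∀ m → M m → Inℤ² (T T′ m)
  T-integral T′ T′-aligns m m∈M =
    let k₂ , ∣m-m₀∣ = dist m m₀ m∈M m₀∈M
        k₃ , ∣m₁-m∣ = dist m₁ m m₁∈M m∈M
        z , ιz≡D[m-m₀] = scaled-integral u (m ℚ².- m₀) (suc K ℕ.* suc K) (k₂ ℕ.* k₂) (k₃ ℕ.* k₃)
                           ∣m₁-m₀∣ ∣m-m₀∣ (trans ∣m₁-m∣ (sym (translate-isMotion m₀ m₁ m)))
        a , b , T′z≡D[a,b] = T′-aligns z (m , m∈M , ιz≡D[m-m₀])
    in  a , b , (begin
      (+ 1 ℚ./ D) ℚ².· T′ (ιℤ (+ D) ℚ².· (m ℚ².- m₀))    ≡⟨ cong (λ x → (+ 1 ℚ./ D) ℚ².· T′ x) ιz≡D[m-m₀] ⟨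
      (+ 1 ℚ./ D) ℚ².· T′ (ι² z)                         ≡⟨ cong ((+ 1 ℚ./ D) ℚ².·_) T′z≡D[a,b] ⟩
      (+ 1 ℚ./ D) ℚ².· ι² (+ D ℤ².· (a , b))              ≡⟨ ι²-unscale D (a , b) ⟩
      ι² (a , b)                                         ∎)

integral-distances⇒movable : ∀ M → IntegralDistances M → ¬ ¬ MovableIntoℤ² M
integral-distances⇒movable M dist = ¬¬-excluded-middle >>= λ where
    (no M≡∅) → pure ((λ z → z) , (λ _ _ → refl) , λ x x∈M → contradiction (x , x∈M) M≡∅)
    (yes (m₀ , m₀∈M)) → ¬¬-excluded-middle {A = PointAtPositiveDistanceFrom m₀} >>= λ where
      (yes (m₁ , m₁∈M , K , ∣m₁-m₀∣)) → movable-given-separated-pair M dist {m₀} {m₁} {K} m₀∈M m₁∈M ∣m₁-m₀∣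
      (no all-at-m₀) → pure ((ℚ²._- m₀) , translate-isMotion m₀ , λ m m∈M → at-m₀ {m₀} all-at-m₀ m m∈M (dist m m₀ m∈M m₀∈M))
  where
  open RawMonad ¬¬-Monad
  PointAtPositiveDistanceFrom : ℚ² → Set
  PointAtPositiveDistanceFrom m₀ = Σ ℚ² λ m₁ → M m₁ × Σ ℕ λ K → DistIs m₁ m₀ (suc K)
  at-m₀ : ∀ {m₀} → ¬ PointAtPositiveDistanceFrom m₀ → ∀ m → M m → Σ ℕ (DistIs m m₀) → Inℤ² (m ℚ².- m₀)
  at-m₀ {m₀} none m m∈M (zero , ∣m-m₀∣)  = + 0 , + 0 , norm≡0⇒≡0 (m ℚ².- m₀) (sym ∣m-m₀∣)
  at-m₀      none m m∈M (suc K , ∣m-m₀∣) = contradiction (m , m∈M , K , ∣m-m₀∣) none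

mainTheorem12 : Part-i × Part-ii
mainTheorem12 = (λ _ → alignable-prime) , integral-distances⇒movable
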